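{- Let $e\ge 2$, let $w\in\tilde{\mathfrak S}_e$ and for $c\in\mathbb Z$ let $\lambda^{(c)}:=w\cdot\emptyset_c$. Then for every $c\in\{1,\dots,e-1\}$, the $c$-charged $e$-core $\lambda^{(c)}$ is obtained from the $(c-1)$-charged $e$-core $\lambda^{(c-1)}$ as follows: 1) let $\mu_{c-1,c}$ be the $(c-1)$-charged partition obtained from $\lambda^{(c-1)}$ by adding the smallest rim hook (i.e. the one with the fewest nodes) with the following two properties: exactly one of its nodes lies in the first column strictly below the first column of the Young diagram of $\lambda^{(c-1)}$, and its hand has residue $w(c)-1 \pmod e$ (residues computed with charge $c-1$); 2) remove the first column of $\mu_{c-1,c}$.
   Context: A partition is a finite non-increasing sequence $\lambda=(\lambda_1\ge\dots\ge\lambda_h>0)$, $h\ge0$; a $c$-charged partition is a partition together with an integer $c$. Its Young diagram is $Y(\lambda)=\{(a,b)\in\mathbb Z^2: 1\le a\le h,\ 1\le b\le\lambda_a\}$ (rows indexed by $a$ going down, columns by $b$ going right). The residue of a node $(a,b)$ of a $c$-charged partition is $b-a+c \bmod e$. The abacus of a $c$-charged partition $\lambda$ is $\{\lambda_k-k+c+1: k\ge1\}\subseteq\mathbb Z$ (with $\lambda_k=0$ for $k>h$); any subset $A\subseteq\mathbb Z$ containing all sufficiently negative integers and no sufficiently large integers is the abacus of a unique charged partition. $\emptyset_c$ denotes the empty $c$-charged partition (abacus $\mathbb Z_{\le c}$). A charged partition with abacus $A$ is an $e$-core if $x\in A\Rightarrow x-e\in A$. The affine symmetric group $\tilde{\mathfrak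 S}_e$ is the group of bijections $w:\mathbb Z\to\mathbb Z$ with $w(i+e)=w(i)+e$ for all $i$ and $w(1)+\dots+w(e)=e(e+1)/2$; it is a Coxeter group with generators $s_0,\dots,s_{e-1}$, where $s_i$ swaps $i+ke$ and $i+1+ke$ for all $k\in\mathbb Z$. It acts on charged partitions by $w\cdot\lambda$ := the charged partition whose abacus is $w(A)$, $A$ the abacus of $\lambda$; this preserves the charge and the set of $e$-cores. For a partition $\lambda$ and a node $\gamma=(a,b)\in Y(\lambda)$, the rim hook $R^\lambda_\gamma=\{(x,y)\in Y(\lambda): x\ge a,\ y\ge b,\ (x+1,y+1)\notin Y(\lambda)\}$; its hand is the node $(a,y)\in R^\lambda_\gamma$ with $y$ maximal. Removing $R$ from $\lambda$ gives the partition with diagram $Y(\lambda)\setminus R$; $\lambda$ is obtained from that partition (same charge) by adding $R$. Removing the first column of a $(c-1)$-charged partition $(\mu_1,\dots,\mu_h)$ gives the $c$-charged partition $(\mu_1-1,\dots,\mu_h-1)$ with zero parts deleted. -}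

module Defs where

open import Data.Nat as ℕ using (ℕ; zero; suc; _≤_; _<_; _≤?_)
import Data.Nat.DivMod as NDM
open import Data.Integer as ℤ using (ℤ; +_)
open import Data.Integer.Divisibility using (_∣_)
open import Data.List using (List; []; _∷_; _++_; map; length; filter; upTo)
open import Data.List.Relation.Unary.All using (All)
open import Data.List.Relation.Unary.Linked using (Linked)
open import Data.Product using (Σ; ∃; _×_; _,_; proj₁; proj₂)
open import Function.Definitions using (Bijective)
open import Relation.Binary.PropositionalEquality using (_≡_)
open import Relation.Nullary using (¬_; Dec)
open import Relation.Nullary.Decidable using (_×-dec_; ¬?)

IsPartition : List ℕ → Set
IsPartition λp = Linked (λ x y → y ≤ x) λp × All (λ x → 0 < x) λp

-- part λ k = λ_k (1-indexed), 0 for k = 0 or k > h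
part : List ℕ → ℕ → ℕ
part []       _             = 0
part (p ∷ ps) zero          = 0
part (p ∷ ps) (suc zero)    = p
part (p ∷ ps) (suc (suc k)) = part ps (suc k)

Node : Set
Node = ℕ × ℕ

-- (a , b) ∈ Y(λ)  (a = row, b = column)
InY : List ℕ → Node → Set
InY λp (a , b) = (1 ≤ a) × (1 ≤ b) × (b ≤ part λp a)

inY? : (λp : List ℕ) (n : Node) → Dec (InY λp n)
inY? λp (a , b) = (1 ≤? a) ×-dec ((1 ≤? b) ×-dec (b ≤? part λp a))

InRim : List ℕ → Node → Node → Set
InRim μ (a , b) (x , y) =
  InY μ (x , y) × (a ≤ x) × (b ≤ y) × ¬ InY μ (suc x , suc y)

inRim? : (μ : List ℕ) (γ : Node) (n : Node) → Dec (InRim μ γ n)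
inRim? μ (a , b) (x , y) =
  inY? μ (x , y) ×-dec ((a ≤? x) ×-dec ((b ≤? y) ×-dec ¬? (inY? μ (suc x , suc y))))

rowNodes : ℕ → ℕ → List Node
rowNodes a len = map (λ b → (a , suc b)) (upTo len)

nodesFrom : ℕ → List ℕ → List Node
nodesFrom a []       = []
nodesFrom a (x ∷ xs) = rowNodes a x ++ nodesFrom (suc a) xs

nodes : List ℕ → List Node
nodes = nodesFrom 1

rimSize : List ℕ → Node → ℕ
rimSize μ γ = length (filter (inRim? μ γ) (nodes μ))

AddsRimHook : List ℕ → List ℕ → Node → Set
AddsRimHook λp μ γ =
  IsPartition μ × InY μ γ ×
  (∀ n → (InY λp n → InY μ n × ¬ InRim μ γ n) × (InY μ n × ¬ InRim μ γ n → InY λp n))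

IsHand : List ℕ → Node → Node → Set
IsHand μ (a , b) (x , y) =
  InRim μ (a , b) (x , y) × x ≡ a × (∀ y' → InRim μ (a , b) (a , y') → y' ≤ y)

residue : ℤ → Node → ℤ
residue c (x , y) = (+ y ℤ.- + x) ℤ.+ c

_≡_[mod_] : ℤ → ℤ → ℕ → Set
x ≡ y [mod e ] = (+ e) ∣ (x ℤ.- y)

InAbacus : List ℕ → ℤ → ℤ → Set
InAbacus λp c x = Σ ℕ λ k → (1 ≤ k) × (x ≡ ((+ part λp k ℤ.- + k) ℤ.+ c) ℤ.+ + 1)

sumFrom1 : (ℤ → ℤ) → ℕ → ℤ
sumFrom1 f zero    = + 0
sumFrom1 f (suc n) = sumFrom1 f n ℤ.+ f (+ suc n)

record AffSym (e : ℕ) : Set where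
  field
    fun      : ℤ → ℤ
    bij      : Bijective _≡_ _≡_ fun
    periodic : ∀ i → fun (i ℤ.+ + e) ≡ fun i ℤ.+ + e
    sumCond  : sumFrom1 fun e ≡ + (e ℕ.* suc e NDM./ 2)

open AffSym public

-- w · (λ , c) = (ν , c) : the abacus of ν (charge c) is w(abacus of λ (charge c))
Acts : ∀ {e} → AffSym e → List ℕ → ℤ → List ℕ → Set
Acts w λp c ν =
  IsPartition ν ×
  (∀ x → (InAbacus ν c x → ∃ λ y → InAbacus λp c y × fun w y ≡ x) ×
         ((∃ λ y → InAbacus λp c y × fun w y ≡ x) → InAbacus ν c x))

-- The hooks of the theorem, for the (cm1)-charged partition λ;
-- target residue r = w(c) - 1.

ExactlyOneBelow : List ℕ → List ℕ → Node → Set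
ExactlyOneBelow λp μ γ =
  ∃ λ x → (InRim μ γ (x , 1) × length λp < x) ×
          (∀ x' → InRim μ γ (x' , 1) → length λp < x' → x' ≡ x)

HandResidue : ℕ → ℤ → ℤ → List ℕ → Node → Set
HandResidue e cm1 r μ γ = ∃ λ h → IsHand μ γ h × residue cm1 h ≡ r [mod e ]

ValidHook : ℕ → ℤ → ℤ → List ℕ → List ℕ → Node → Set
ValidHook e cm1 r λp μ γ =
  AddsRimHook λp μ γ × ExactlyOneBelow λp μ γ × HandResidue e cm1 r μ γ

SmallestHook : ℕ → ℤ → ℤ → List ℕ → List ℕ → Node → Set
SmallestHook e cm1 r λp μ γ =
  ValidHook e cm1 r λp μ γ ×
  (∀ μ' γ' → ValidHook e cm1 r λp μ' γ' → rimSize μ γ ≤ rimSize μ' γ')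

removeFirstColumn : List ℕ → List ℕ
removeFirstColumn []            = []
removeFirstColumn (zero ∷ xs)    = removeFirstColumn xs
removeFirstColumn (suc zero ∷ xs) = removeFirstColumn xs
removeFirstColumn (suc (suc n) ∷ xs) = suc n ∷ removeFirstColumn xs

-- The proof works on the abacus. The abacus of ∅_c is that of ∅_(c−1) plus the position c, so the
-- abacus of λ^(c) is that of λ = λ^(c−1) plus q = w(c). Adding to λ a rim hook with exactly one node in the
-- first column below λ amounts to inserting a row of length m as row j + 1 and lengthening every later row
-- by one; after removing the first column the (c-charged) abacus is that of λ plus p = m − j + (c − 1), the
-- hand condition reads p ≡ q (mod e), and the hook has p − (c − 1) + length λ nodes. As λ is an e-core,
-- every position p ≡ q outside its abacus satisfies p ≥ q, and p = q is attained. So the smallest hook is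
-- the one with p = q, and removing its first column gives the partition whose abacus is that of λ plus q,
-- namely λ^(c).

module Submission where

open import Defs
open import Data.Nat using (ℕ; _≤_; _<_)
open import Data.Integer as ℤ using (ℤ; +_; _-_)
open import Data.List using (List; [])
open import Data.Product using (∃; ∃₂; _×_)
open import Relation.Binary.PropositionalEquality using (_≡_)

open import Data.Empty using (⊥-elim)
open import Data.Integer.Divisibility using (_∣_)
import Data.Integer.Properties as ℤₚ
open import Data.Integer.Tactic.RingSolver using (solve-∀)
open import Data.List using (_∷_; _++_; map; length; filter; applyUpTo; drop)
import Data.List.Properties as Listₚ
open import Data.List.Relation.Unary.All using (All; []; _∷_; universal)
import Data.List.Relation.Unary.All.Properties as Allₚ
open import Data.List.Relation.Unary.Linked using (Linked; []; [-]; _∷_)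
  renaming (tail to linked-tail; map to linked-map)
import Data.List.Relation.Unary.Linked.Properties as Linkedₚ
open import Data.Nat as ℕ using (zero; suc; z≤n; s≤s)
open import Data.Nat.Divisibility using (divides)
open import Data.Nat.Induction using (<-rec)
open import Data.Nat.ListAction using (sum)
import Data.Nat.Properties as ℕₚ
import Data.Nat.Tactic.RingSolver as ℕSolver
open import Data.Product using (Σ; _,_; proj₁; proj₂)
open import Data.Sum using (_⊎_; inj₁; inj₂)
open import Function using (_∘_)
open import Function.Bundles using (_⇔_; mk⇔; Equivalence)
import Function.Properties.Equivalence as ⇔
open import Level using (0ℓ)
open import Relation.Binary.Definitions using (tri<; tri≈; tri>)
open import Relation.Binary.PropositionalEquality
  using (refl; sym; trans; cong; cong₂; subst; subst₂; module ≡-Reasoning)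
open import Relation.Nullary using (¬_; Dec; yes; no)
open import Relation.Unary using (Pred; Decidable)

i+j-j≡i : ∀ i j → (i ℤ.+ j) - j ≡ i
i+j-j≡i = solve-∀

+-cancelʳ-≡ : ∀ k {i j} → i ℤ.+ k ≡ j ℤ.+ k → i ≡ j
+-cancelʳ-≡ k {i} {j} p = trans (sym (i+j-j≡i i k)) (trans (cong (_- k) p) (i+j-j≡i j k))

+-cancelʳ-< : ∀ k {i j} → i ℤ.+ k ℤ.< j ℤ.+ k → i ℤ.< j
+-cancelʳ-< k {i} {j} p = subst₂ ℤ._<_ (i+j-j≡i i k) (i+j-j≡i j k) (ℤₚ.+-monoˡ-< (ℤ.- k) p)

+-cancelʳ-≤ : ∀ k {i j} → i ℤ.+ k ℤ.≤ j ℤ.+ k → i ℤ.≤ j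
+-cancelʳ-≤ k {i} {j} p = subst₂ ℤ._≤_ (i+j-j≡i i k) (i+j-j≡i j k) (ℤₚ.+-monoˡ-≤ (ℤ.- k) p)

≤⇒≡+ : ∀ {i j} → i ℤ.≤ j → ∃ λ d → j ≡ i ℤ.+ + d
≤⇒≡+ {i} {j} i≤j = ℤ.∣ j - i ∣ , (begin
  j                   ≡⟨ identity i j ⟩
  i ℤ.+ (j - i)       ≡⟨ cong (λ t → i ℤ.+ t) (sym (ℤₚ.0≤i⇒+∣i∣≡i (ℤₚ.i≤j⇒0≤j-i i≤j))) ⟩
  i ℤ.+ + ℤ.∣ j - i ∣ ∎)
  where
  open ≡-Reasoning
  identity : ∀ i j → j ≡ i ℤ.+ (j - i)
  identity = solve-∀

≤-byElements : ∀ {u v} → (∀ {y} → 1 ≤ y → y ≤ u → y ≤ v) → u ≤ v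
≤-byElements {zero} _ = z≤n
≤-byElements {suc u} f = f (s≤s z≤n) ℕₚ.≤-refl

suc≤⇒≤∸1 : ∀ {y n} → suc y ≤ n → y ≤ n ℕ.∸ 1
suc≤⇒≤∸1 (s≤s y<n) = y<n

≤∸1⇒suc≤ : ∀ {y n} → 1 ≤ y → y ≤ n ℕ.∸ 1 → suc y ≤ n
≤∸1⇒suc≤ {n = zero} (s≤s z≤n) ()
≤∸1⇒suc≤ {n = suc n} _ y≤n = s≤s y≤n

∸1≡0⇒≤1 : ∀ {n} → n ℕ.∸ 1 ≡ 0 → n ≤ 1
∸1≡0⇒≤1 {zero} _ = z≤n
∸1≡0⇒≤1 {suc zero} _ = s≤s z≤n

≤⇒suc[∸1]≤ : ∀ {n m} → n ≤ m → 1 ≤ m → suc (n ℕ.∸ 1) ≤ m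
≤⇒suc[∸1]≤ {zero} _ 1≤m = 1≤m
≤⇒suc[∸1]≤ {suc n} n<m _ = n<m

≤1⇒∸1≡0 : ∀ {n} → n ≤ 1 → n ℕ.∸ 1 ≡ 0
≤1⇒∸1≡0 z≤n = refl
≤1⇒∸1≡0 (s≤s z≤n) = refl

least-witness : ∀ {P : ℕ → Set} → (∀ n → Dec (P n)) → ∀ {n} → P n →
  ∃ λ k → k ≤ n × P k × (∀ {i} → i < k → ¬ P i)
least-witness P? {zero} p = 0 , z≤n , p , λ ()
least-witness P? {suc n} p with P? 0
... | yes p₀ = 0 , z≤n , p₀ , λ ()
... | no ¬p₀ with least-witness (P? ∘ suc) {n} p
...   | k , k≤n , pₖ , below = suc k , s≤s k≤n , pₖ , λ { {zero} _ → ¬p₀ ; {suc i} (s≤s i<k) → below i<k }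

-- Bead positions on the abacus

-- bead (part λ k) k c is the position of the bead of row k of the c-charged λ (cf. InAbacus).
bead : ℕ → ℕ → ℤ → ℤ
bead a k c = ((+ a - + k) ℤ.+ c) ℤ.+ + 1

bead+k+k′ : ∀ a k k′ c → bead a k c ℤ.+ (+ k ℤ.+ + k′) ≡ + (a ℕ.+ k′) ℤ.+ (c ℤ.+ + 1)
bead+k+k′ a k k′ c rewrite ℤₚ.pos-+ a k′ = shift (+ a) (+ k) (+ k′) c
  where
  shift : ∀ a k k′ c → (((a - k) ℤ.+ c) ℤ.+ + 1) ℤ.+ (k ℤ.+ k′) ≡ (a ℤ.+ k′) ℤ.+ (c ℤ.+ + 1)
  shift = solve-∀

bead+k′+k : ∀ a k k′ c → bead a k c ℤ.+ (+ k′ ℤ.+ + k) ≡ + (a ℕ.+ k′) ℤ.+ (c ℤ.+ + 1)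
bead+k′+k a k k′ c = trans (cong (λ t → bead a k c ℤ.+ t) (ℤₚ.+-comm (+ k′) (+ k))) (bead+k+k′ a k k′ c)

bead-≡⇒ : ∀ {a k a′ k′ c} → bead a k c ≡ bead a′ k′ c → a ℕ.+ k′ ≡ a′ ℕ.+ k
bead-≡⇒ {a} {k} {a′} {k′} {c} p = ℤₚ.+-injective (+-cancelʳ-≡ (c ℤ.+ + 1)
  (trans (sym (bead+k+k′ a k k′ c)) (trans (cong (ℤ._+ (+ k ℤ.+ + k′)) p) (bead+k′+k a′ k′ k c))))

bead-<⇒ : ∀ {a k a′ k′ c} → bead a k c ℤ.< bead a′ k′ c → a ℕ.+ k′ ℕ.< a′ ℕ.+ k
bead-<⇒ {a} {k} {a′} {k′} {c} p = ℤₚ.drop‿+<+ (+-cancelʳ-< (c ℤ.+ + 1)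
  (subst₂ ℤ._<_ (bead+k+k′ a k k′ c) (bead+k′+k a′ k′ k c) (ℤₚ.+-monoˡ-< (+ k ℤ.+ + k′) p)))

>bead⇒≡bead : ∀ {a k c x} → bead a k c ℤ.< x → ∃ λ n → x ≡ bead (a ℕ.+ suc n) k c
>bead⇒≡bead {a} {k} {c} {x} b<x with ≤⇒≡+ (ℤₚ.i<j⇒suc[i]≤j b<x)
... | n , x≡ = n , trans x≡ shifted
  where
  shift : ∀ a k c n → (+ 1 ℤ.+ (((a - k) ℤ.+ c) ℤ.+ + 1)) ℤ.+ n ≡ (((a ℤ.+ (+ 1 ℤ.+ n)) - k) ℤ.+ c) ℤ.+ + 1
  shift = solve-∀
  shifted : ℤ.suc (bead a k c) ℤ.+ + n ≡ bead (a ℕ.+ suc n) k c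
  shifted rewrite ℤₚ.pos-+ a (suc n) | ℤₚ.pos-+ 1 n = shift (+ a) (+ k) c (+ n)

≤bead⇒≡bead : ∀ {k c x} → x ℤ.≤ bead 0 k c → ∃ λ d → x ≡ bead 0 (k ℕ.+ d) c
≤bead⇒≡bead {k} {c} {x} x≤b with ≤⇒≡+ x≤b
... | d , b≡x+d = d , (begin
  x                 ≡⟨ sym (i+j-j≡i x (+ d)) ⟩
  (x ℤ.+ + d) - + d ≡⟨ cong (_- + d) (sym b≡x+d) ⟩
  bead 0 k c - + d  ≡⟨ shift ⟩
  bead 0 (k ℕ.+ d) c ∎)
  where
  open ≡-Reasoning
  shift : bead 0 k c - + d ≡ bead 0 (k ℕ.+ d) c
  shift rewrite ℤₚ.pos-+ k d = identity (+ k) (+ d) c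
    where
    identity : ∀ k d c → (((+ 0 - k) ℤ.+ c) ℤ.+ + 1) - d ≡ ((+ 0 - (k ℤ.+ d)) ℤ.+ c) ℤ.+ + 1
    identity = solve-∀

bead-shiftPart : ∀ a k c → bead (suc a) k (c - + 1) ≡ bead a k c
bead-shiftPart a k c rewrite ℤₚ.pos-+ 1 a = identity (+ a) (+ k) c
  where
  identity : ∀ a k c → (((+ 1 ℤ.+ a) - k) ℤ.+ (c - + 1)) ℤ.+ + 1 ≡ ((a - k) ℤ.+ c) ℤ.+ + 1
  identity = solve-∀

bead-∸1 : ∀ {a} k c → 1 ≤ a → bead (a ℕ.∸ 1) k c ≡ bead a k (c - + 1)
bead-∸1 {suc a} k c _ = sym (bead-shiftPart a k c)

bead-shiftRow : ∀ a k c → bead a (suc k) c ≡ bead a k (c - + 1)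
bead-shiftRow a k c rewrite ℤₚ.pos-+ 1 k = identity (+ a) (+ k) c
  where
  identity : ∀ a k c → ((a - (+ 1 ℤ.+ k)) ℤ.+ c) ℤ.+ + 1 ≡ ((a - k) ℤ.+ (c - + 1)) ℤ.+ + 1
  identity = solve-∀

bead-emptyRow : ∀ k c → bead 0 (suc k) c ≡ c - + k
bead-emptyRow k c rewrite ℤₚ.pos-+ 1 k = identity (+ k) c
  where
  identity : ∀ k c → ((+ 0 - (+ 1 ℤ.+ k)) ℤ.+ c) ℤ.+ + 1 ≡ c - k
  identity = solve-∀

∈abacus∅⇒≤ : ∀ {c y} → InAbacus [] c y → y ℤ.≤ c
∈abacus∅⇒≤ {c} (suc k , _ , refl) =
  subst (ℤ._≤ c) (sym (bead-emptyRow k c)) (ℤₚ.i≤j⇒i-k≤j (+ k) ℤₚ.≤-refl)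

≤⇒∈abacus∅ : ∀ {c y} → y ℤ.≤ c → InAbacus [] c y
≤⇒∈abacus∅ {c} {y} y≤c
  with ≤bead⇒≡bead {1} {c} (subst (y ℤ.≤_) (sym (trans (bead-emptyRow 0 c) (ℤₚ.+-identityʳ c))) y≤c)
... | d , y≡ = suc d , s≤s z≤n , y≡

residue≡⇔bead≡ : ∀ {e} c k a r → residue c (k , a) ≡ r - + 1 [mod e ] ⇔ bead a k c ≡ r [mod e ]
residue≡⇔bead≡ {e} c k a r = mk⇔ (subst (+ e ∣_) (identity (residue c (k , a)) r))
                                 (subst (+ e ∣_) (sym (identity (residue c (k , a)) r)))
  where
  identity : ∀ x r → x - (r - + 1) ≡ (x ℤ.+ + 1) - r
  identity = solve-∀

-- Partitions and their abacus

Positive : List ℕ → Set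
Positive = All (λ x → 0 < x)

NonIncreasing : List ℕ → Set
NonIncreasing L = ∀ {i j} → 1 ≤ i → i ≤ j → part L j ≤ part L i

part-zero : ∀ L → part L 0 ≡ 0
part-zero [] = refl
part-zero (_ ∷ _) = refl

part-length< : ∀ L {k} → length L < k → part L k ≡ 0
part-length< [] _ = refl
part-length< (x ∷ L) {suc (suc k)} (s≤s h<k) = part-length< L h<k

part-positive : ∀ {L} → Positive L → ∀ {k} → 1 ≤ k → k ≤ length L → 0 < part L k
part-positive (p ∷ _) {suc zero} _ _ = p
part-positive (_ ∷ ps) {suc (suc k)} _ (s≤s k≤h) = part-positive ps (s≤s z≤n) k≤h

part>0⇒≤length : ∀ L {k} → 0 < part L k → k ≤ length L
part>0⇒≤length (x ∷ L) {suc zero} _ = s≤s z≤n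
part>0⇒≤length (x ∷ L) {suc (suc k)} p = s≤s (part>0⇒≤length L p)

part-descends : ∀ {L} → Linked (λ x y → y ≤ x) L → ∀ i → part L (suc (suc i)) ≤ part L (suc i)
part-descends [] i = z≤n
part-descends [-] i = z≤n
part-descends (x≥y ∷ _) zero = x≥y
part-descends (_ ∷ l) (suc i) = part-descends l i

isPartition⇒nonIncreasing : ∀ {L} → IsPartition L → NonIncreasing L
isPartition⇒nonIncreasing {L} (linked , _) 1≤i i≤j = go 1≤i (ℕₚ.≤⇒≤′ i≤j)
  where
  go : ∀ {i j} → 1 ≤ i → i ℕ.≤′ j → part L j ≤ part L i
  go _ ℕ.≤′-refl = ℕₚ.≤-refl
  go {suc i} {suc (suc j)} 1≤i (ℕ.≤′-step i≤′j) = ℕₚ.≤-trans (part-descends linked j) (go 1≤i i≤′j)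
  go {suc i} {suc zero} _ (ℕ.≤′-step i<′1) with () ← ℕₚ.≤′⇒≤ i<′1

nonIncreasing-tail : ∀ {x L} → NonIncreasing (x ∷ L) → NonIncreasing L
nonIncreasing-tail desc {suc i} {suc j} _ i≤j = desc (s≤s z≤n) (s≤s i≤j)

part-ext : ∀ {L L′} → Positive L → Positive L′ → (∀ k → 1 ≤ k → part L k ≡ part L′ k) → L ≡ L′
part-ext [] [] eq = refl
part-ext [] (p ∷ _) eq = ⊥-elim (ℕₚ.<-irrefl (eq 1 (s≤s z≤n)) p)
part-ext (p ∷ _) [] eq = ⊥-elim (ℕₚ.<-irrefl (sym (eq 1 (s≤s z≤n))) p)
part-ext (_ ∷ ps) (_ ∷ qs) eq =
  cong₂ _∷_ (eq 1 (s≤s z≤n)) (part-ext ps qs λ { (suc k) _ → eq (suc (suc k)) (s≤s z≤n) })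

≤bottom⇒∈abacus : ∀ {L c x} → x ℤ.≤ bead 0 (suc (length L)) c → InAbacus L c x
≤bottom⇒∈abacus {L} {c} {x} x≤bottom with ≤bead⇒≡bead {suc (length L)} {c} x≤bottom
... | d , x≡ = suc (length L) ℕ.+ d , s≤s z≤n ,
  trans x≡ (cong (λ a → bead a (suc (length L) ℕ.+ d) c) (sym (part-length< L (s≤s (ℕₚ.m≤m+n _ d)))))

part+row-strict : ∀ {ν i j} → NonIncreasing ν → 1 ≤ i → i < j → part ν j ℕ.+ i < part ν i ℕ.+ j
part+row-strict desc 1≤i i<j = ℕₚ.+-mono-≤-< (desc 1≤i (ℕₚ.<⇒≤ i<j)) i<j

-- The bead of row k of ν is the bead of some row i of ν′; the rows above k agree and bead positions
-- strictly decrease down the rows, so i ≥ k.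
part≤-fromAbacus : ∀ {ν ν′} c → NonIncreasing ν → NonIncreasing ν′ →
  (∀ x → InAbacus ν c x → InAbacus ν′ c x) →
  ∀ {k} → 1 ≤ k → (∀ {i} → 1 ≤ i → i < k → part ν i ≡ part ν′ i) → part ν k ≤ part ν′ k
part≤-fromAbacus {ν} {ν′} c desc desc′ ν⊆ν′ {k} 1≤k agree with ν⊆ν′ _ (k , 1≤k , refl)
... | i , 1≤i , same-bead with bead-≡⇒ {part ν k} {k} {part ν′ i} {i} {c} same-bead | ℕₚ.<-cmp i k
...   | eq | tri< i<k _ _ = ⊥-elim (ℕₚ.<-irrefl (trans eq (cong (ℕ._+ k) (sym (agree 1≤i i<k))))
                                                 (part+row-strict {ν} desc 1≤i i<k))
...   | eq | tri≈ _ refl _ = ℕₚ.≤-reflexive (ℕₚ.+-cancelʳ-≡ k _ _ eq)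
...   | eq | tri> _ _ k<i = ℕₚ.<⇒≤ (ℕₚ.+-cancelʳ-< i _ _
                              (subst (ℕ._< part ν′ k ℕ.+ i) (sym eq) (part+row-strict {ν′} desc′ 1≤k k<i)))

abacus-injective : ∀ {ν ν′} c → Positive ν → NonIncreasing ν → Positive ν′ → NonIncreasing ν′ →
  (∀ x → InAbacus ν c x ⇔ InAbacus ν′ c x) → ν ≡ ν′
abacus-injective {ν} {ν′} c pos desc pos′ desc′ same =
  part-ext pos pos′ (<-rec (λ k → 1 ≤ k → part ν k ≡ part ν′ k) agree)
  where
  open Equivalence
  agree : ∀ k → (∀ {i} → i < k → 1 ≤ i → part ν i ≡ part ν′ i) → 1 ≤ k → part ν k ≡ part ν′ k
  agree k earlier 1≤k = ℕₚ.≤-antisym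
    (part≤-fromAbacus {ν} {ν′} c desc desc′ (λ x → to (same x)) 1≤k (λ 1≤i i<k → earlier i<k 1≤i))
    (part≤-fromAbacus {ν′} {ν} c desc′ desc (λ x → from (same x)) 1≤k (λ 1≤i i<k → sym (earlier i<k 1≤i)))

part≤head : ∀ {x L} → NonIncreasing (x ∷ L) → ∀ k → part (x ∷ L) k ≤ x
part≤head desc zero = z≤n
part≤head desc (suc k) = desc {1} {suc k} (s≤s z≤n) (s≤s z≤n)

part-tail≤head : ∀ {x L} → NonIncreasing (x ∷ L) → ∀ k → part L k ≤ x
part-tail≤head {L = L} desc zero = subst (_≤ _) (sym (part-zero L)) z≤n
part-tail≤head desc (suc k) = part≤head desc (suc (suc k))

part∸1-dropShortHead : ∀ {x L} → x ≤ 1 → NonIncreasing (x ∷ L) →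
  ∀ k → part L k ℕ.∸ 1 ≡ part (x ∷ L) k ℕ.∸ 1
part∸1-dropShortHead x≤1 desc k = trans (≤1⇒∸1≡0 (ℕₚ.≤-trans (part-tail≤head desc k) x≤1))
                              (sym (≤1⇒∸1≡0 (ℕₚ.≤-trans (part≤head desc k) x≤1)))

part-removeFirstColumn : ∀ L → NonIncreasing L → ∀ k → part (removeFirstColumn L) k ≡ part L k ℕ.∸ 1
part-removeFirstColumn [] _ k = refl
part-removeFirstColumn (zero ∷ L) desc k =
  trans (part-removeFirstColumn L (nonIncreasing-tail desc) k) (part∸1-dropShortHead z≤n desc k)
part-removeFirstColumn (suc zero ∷ L) desc k =
  trans (part-removeFirstColumn L (nonIncreasing-tail desc) k) (part∸1-dropShortHead ℕₚ.≤-refl desc k)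
part-removeFirstColumn (suc (suc n) ∷ L) desc zero = refl
part-removeFirstColumn (suc (suc n) ∷ L) desc (suc zero) = refl
part-removeFirstColumn (suc (suc n) ∷ L) desc (suc (suc k)) =
  part-removeFirstColumn L (nonIncreasing-tail desc) (suc k)

positive-removeFirstColumn : ∀ L → Positive (removeFirstColumn L)
positive-removeFirstColumn [] = []
positive-removeFirstColumn (zero ∷ L) = positive-removeFirstColumn L
positive-removeFirstColumn (suc zero ∷ L) = positive-removeFirstColumn L
positive-removeFirstColumn (suc (suc n) ∷ L) = s≤s z≤n ∷ positive-removeFirstColumn L

nonIncreasing-removeFirstColumn : ∀ L → NonIncreasing L → NonIncreasing (removeFirstColumn L)
nonIncreasing-removeFirstColumn L desc {i} {j} 1≤i i≤j
  rewrite part-removeFirstColumn L desc i | part-removeFirstColumn L desc j = ℕₚ.∸-monoˡ-≤ 1 (desc 1≤i i≤j)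

-- Inserting a row

-- insertRow j m L is L plus the rim hook from row j + 1 to the node (length L + 1 , 1): its row j + 1
-- has length m, the rows above are those of L, and each row below is one longer than the row of L above it.
insertRow : ℕ → ℕ → List ℕ → List ℕ
insertRow zero m L = m ∷ map suc L
insertRow (suc j) m [] = m ∷ []
insertRow (suc j) m (x ∷ L) = x ∷ insertRow j m L

-- The conditions under which insertRow j m L is a partition.
record Fits (L : List ℕ) (j m : ℕ) : Set where
  field
    j≤length : j ≤ length L
    part<m : part L (suc j) < m
    m≤part : ∀ {k} → 1 ≤ k → k ≤ j → m ≤ part L k

part-map-suc : ∀ L {k} → 1 ≤ k → k ≤ length L → part (map suc L) k ≡ suc (part L k)
part-map-suc (x ∷ L) {suc zero} _ _ = refl
part-map-suc (x ∷ L) {suc (suc k)} _ (s≤s k≤h) = part-map-suc L (s≤s z≤n) k≤h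

part-map-suc-∸1 : ∀ L k → part (map suc L) k ℕ.∸ 1 ≡ part L k
part-map-suc-∸1 [] k = refl
part-map-suc-∸1 (x ∷ L) zero = refl
part-map-suc-∸1 (x ∷ L) (suc zero) = refl
part-map-suc-∸1 (x ∷ L) (suc (suc k)) = part-map-suc-∸1 L (suc k)

length-insertRow : ∀ {j} m L → j ≤ length L → length (insertRow j m L) ≡ suc (length L)
length-insertRow {zero} m L _ = cong suc (Listₚ.length-map suc L)
length-insertRow {suc j} m (x ∷ L) (s≤s j≤h) = cong suc (length-insertRow m L j≤h)

part-insertRow-≤ : ∀ {j} m L {k} → 1 ≤ k → k ≤ j → j ≤ length L → part (insertRow j m L) k ≡ part L k
part-insertRow-≤ {suc j} m (x ∷ L) {suc zero} _ _ _ = refl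
part-insertRow-≤ {suc j} m (x ∷ L) {suc (suc k)} _ (s≤s k≤j) (s≤s j≤h) = part-insertRow-≤ m L (s≤s z≤n) k≤j j≤h

part-insertRow-new : ∀ {j} m L → j ≤ length L → part (insertRow j m L) (suc j) ≡ m
part-insertRow-new {zero} m L _ = refl
part-insertRow-new {suc j} m (x ∷ L) (s≤s j≤h) = part-insertRow-new m L j≤h

part-insertRow-> : ∀ {j} m L {k} → j < k → j ≤ length L → part (insertRow j m L) (suc k) ≡ part (map suc L) k
part-insertRow-> {zero} m L {suc k} _ _ = refl
part-insertRow-> {suc j} m (x ∷ L) {suc (suc k)} (s≤s j<k) (s≤s j≤h) = part-insertRow-> m L j<k j≤h

sum-map-suc : ∀ L → sum (map suc L) ≡ sum L ℕ.+ length L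
sum-map-suc [] = refl
sum-map-suc (x ∷ L) = begin
  suc (x ℕ.+ sum (map suc L))        ≡⟨ cong (λ t → suc (x ℕ.+ t)) (sum-map-suc L) ⟩
  suc (x ℕ.+ (sum L ℕ.+ length L))   ≡⟨ identity x (sum L) (length L) ⟩
  (x ℕ.+ sum L) ℕ.+ suc (length L)   ∎
  where
  open ≡-Reasoning
  identity : ∀ x s h → suc (x ℕ.+ (s ℕ.+ h)) ≡ (x ℕ.+ s) ℕ.+ suc h
  identity = ℕSolver.solve-∀

sum-insertRow : ∀ {j} m L → j ≤ length L → sum (insertRow j m L) ℕ.+ j ≡ (sum L ℕ.+ m) ℕ.+ length L
sum-insertRow {zero} m L _ = begin
  (m ℕ.+ sum (map suc L)) ℕ.+ 0    ≡⟨ cong (λ t → (m ℕ.+ t) ℕ.+ 0) (sum-map-suc L) ⟩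
  (m ℕ.+ (sum L ℕ.+ length L)) ℕ.+ 0 ≡⟨ identity m (sum L) (length L) ⟩
  (sum L ℕ.+ m) ℕ.+ length L       ∎
  where
  open ≡-Reasoning
  identity : ∀ m s h → (m ℕ.+ (s ℕ.+ h)) ℕ.+ 0 ≡ (s ℕ.+ m) ℕ.+ h
  identity = ℕSolver.solve-∀
sum-insertRow {suc j} m (x ∷ L) (s≤s j≤h) = begin
  (x ℕ.+ sum (insertRow j m L)) ℕ.+ suc j   ≡⟨ identity₁ x (sum (insertRow j m L)) j ⟩
  x ℕ.+ suc (sum (insertRow j m L) ℕ.+ j)   ≡⟨ cong (λ t → x ℕ.+ suc t) (sum-insertRow m L j≤h) ⟩
  x ℕ.+ suc ((sum L ℕ.+ m) ℕ.+ length L)    ≡⟨ identity₂ x (sum L) m (length L) ⟩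
  ((x ℕ.+ sum L) ℕ.+ m) ℕ.+ suc (length L)  ∎
  where
  open ≡-Reasoning
  identity₁ : ∀ x s j → (x ℕ.+ s) ℕ.+ suc j ≡ x ℕ.+ suc (s ℕ.+ j)
  identity₁ = ℕSolver.solve-∀
  identity₂ : ∀ x s m h → x ℕ.+ suc ((s ℕ.+ m) ℕ.+ h) ≡ ((x ℕ.+ s) ℕ.+ m) ℕ.+ suc h
  identity₂ = ℕSolver.solve-∀

positive-insertRow : ∀ {j m} L → Positive L → 0 < m → Positive (insertRow j m L)
positive-insertRow {zero} L _ m>0 = m>0 ∷ Allₚ.map⁺ (universal (λ _ → s≤s z≤n) L)
positive-insertRow {suc j} [] _ m>0 = m>0 ∷ []
positive-insertRow {suc j} (x ∷ L) (x>0 ∷ pos) m>0 = x>0 ∷ positive-insertRow L pos m>0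

Fits-tail : ∀ {x L j m} → Fits (x ∷ L) (suc j) m → Fits L j m
Fits-tail fits = record
  { j≤length = ℕ.s≤s⁻¹ j≤length
  ; part<m = part<m
  ; m≤part = λ { {suc k} _ (s≤s k≤j) → m≤part (s≤s z≤n) (s≤s (s≤s k≤j)) }
  }
  where open Fits fits

linked-insertRow : ∀ {j m} L → Linked (λ x y → y ≤ x) L → Fits L j m → Linked (λ x y → y ≤ x) (insertRow j m L)
linked-insertRow {zero} [] _ _ = [-]
linked-insertRow {zero} (y ∷ L) linked fits = Fits.part<m fits ∷ Linkedₚ.map⁺ (linked-map s≤s linked)
linked-insertRow {suc zero} (x ∷ L) linked fits =
  Fits.m≤part fits (s≤s z≤n) (s≤s z≤n) ∷ linked-insertRow L (linked-tail linked) (Fits-tail fits)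
linked-insertRow {suc (suc j)} (x ∷ []) _ fits with s≤s () ← Fits.j≤length fits
linked-insertRow {suc (suc j)} (x ∷ y ∷ L) (x≥y ∷ linked) fits =
  x≥y ∷ linked-insertRow (y ∷ L) linked (Fits-tail fits)

insertRow-isPartition : ∀ {j m L} → IsPartition L → Fits L j m → IsPartition (insertRow j m L)
insertRow-isPartition {L = L} (linked , pos) fits =
  linked-insertRow L linked fits , positive-insertRow L pos (ℕₚ.<-≤-trans (s≤s z≤n) (Fits.part<m fits))

abacus-removeFirstColumn-insertRow : ∀ {L j m} → IsPartition L → Fits L j m → ∀ c x →
  InAbacus (removeFirstColumn (insertRow j m L)) c x ⇔ (InAbacus L (c - + 1) x ⊎ x ≡ bead m (suc j) (c - + 1))
abacus-removeFirstColumn-insertRow {L} {j} {m} L-partition fits c x = mk⇔ to from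
  where
  open Fits fits
  μ : List ℕ
  μ = insertRow j m L
  ν : List ℕ
  ν = removeFirstColumn μ
  part-ν : ∀ k → part ν k ≡ part μ k ℕ.∸ 1
  part-ν = part-removeFirstColumn μ (isPartition⇒nonIncreasing (insertRow-isPartition L-partition fits))
  1≤m : 1 ≤ m
  1≤m = ℕₚ.<-≤-trans (s≤s z≤n) part<m

  bead-ν-above : ∀ {k} → 1 ≤ k → k ≤ j → bead (part ν k) k c ≡ bead (part L k) k (c - + 1)
  bead-ν-above {k} 1≤k k≤j = trans
    (cong (λ t → bead t k c) (trans (part-ν k) (cong (ℕ._∸ 1) (part-insertRow-≤ m L 1≤k k≤j j≤length))))
    (bead-∸1 k c (ℕₚ.≤-trans 1≤m (m≤part 1≤k k≤j)))
  bead-ν-new : bead (part ν (suc j)) (suc j) c ≡ bead m (suc j) (c - + 1)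
  bead-ν-new = trans
    (cong (λ t → bead t (suc j) c) (trans (part-ν (suc j)) (cong (ℕ._∸ 1) (part-insertRow-new m L j≤length))))
    (bead-∸1 (suc j) c 1≤m)
  bead-ν-below : ∀ {k} → j < k → bead (part ν (suc k)) (suc k) c ≡ bead (part L k) k (c - + 1)
  bead-ν-below {k} j<k = trans
    (cong (λ t → bead t (suc k) c) (trans (part-ν (suc k))
      (trans (cong (ℕ._∸ 1) (part-insertRow-> m L j<k j≤length)) (part-map-suc-∸1 L k))))
    (bead-shiftRow (part L k) k c)

  to : InAbacus ν c x → InAbacus L (c - + 1) x ⊎ x ≡ bead m (suc j) (c - + 1)
  to (suc k , _ , x≡) with ℕₚ.<-cmp k j
  ... | tri< k<j _ _ = inj₁ (suc k , s≤s z≤n , trans x≡ (bead-ν-above (s≤s z≤n) k<j))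
  ... | tri≈ _ refl _ = inj₂ (trans x≡ bead-ν-new)
  ... | tri> _ _ j<k = inj₁ (k , ℕₚ.<-≤-trans (s≤s z≤n) j<k , trans x≡ (bead-ν-below j<k))

  from : InAbacus L (c - + 1) x ⊎ x ≡ bead m (suc j) (c - + 1) → InAbacus ν c x
  from (inj₁ (k , 1≤k , x≡)) with k ℕ.≤? j
  ... | yes k≤j = k , 1≤k , trans x≡ (sym (bead-ν-above 1≤k k≤j))
  ... | no k≰j = suc k , s≤s z≤n , trans x≡ (sym (bead-ν-below (ℕₚ.≰⇒> k≰j)))
  from (inj₂ x≡) = suc j , s≤s z≤n , trans x≡ (sym bead-ν-new)

fits⇒bead∉abacus : ∀ {L j m c} → IsPartition L → Fits L j m → ¬ InAbacus L c (bead m (suc j) c)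
fits⇒bead∉abacus {L} {j} {m} {c} L-partition fits (k , 1≤k , bead≡)
  with bead-≡⇒ {m} {suc j} {part L k} {k} {c} bead≡
... | m+k≡ with k ℕ.≤? j
...   | yes k≤j = ℕₚ.<-irrefl m+k≡ (ℕₚ.+-mono-≤-< (m≤part 1≤k k≤j) (s≤s k≤j))
  where open Fits fits
...   | no k≰j = ℕₚ.<-irrefl (sym m+k≡) (ℕₚ.+-mono-<-≤ (ℕₚ.≤-<-trans part[k]≤ part<m) (ℕₚ.≰⇒> k≰j))
  where
  open Fits fits
  part[k]≤ : part L k ≤ part L (suc j)
  part[k]≤ = isPartition⇒nonIncreasing L-partition (s≤s z≤n) (ℕₚ.≰⇒> k≰j)

-- Row j + 1 is the first row whose bead lies below q.
gap⇒fits : ∀ {L c q} → IsPartition L → ¬ InAbacus L c q → bead 0 (suc (length L)) c ℤ.< q →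
  ∃₂ λ j m → Fits L j m × q ≡ bead m (suc j) c
gap⇒fits {L} {c} {q} L-partition q∉L bottom<q with least-witness P? {length L} bottom-row
  where
  P : ℕ → Set
  P k = bead (part L (suc k)) (suc k) c ℤ.< q
  P? : ∀ k → Dec (P k)
  P? k = bead (part L (suc k)) (suc k) c ℤ.<? q
  bottom-row : P (length L)
  bottom-row = subst (λ a → bead a (suc (length L)) c ℤ.< q) (sym (part-length< L ℕₚ.≤-refl)) bottom<q
... | j , j≤h , bead<q , above-q with >bead⇒≡bead {part L (suc j)} {suc j} {c} bead<q
...   | n , q≡ = j , part L (suc j) ℕ.+ suc n , fits , q≡
  where
  m : ℕ
  m = part L (suc j) ℕ.+ suc n
  q<bead : ∀ {i} → i < j → q ℤ.< bead (part L (suc i)) (suc i) c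
  q<bead {i} i<j = ℤₚ.≤∧≢⇒< (ℤₚ.≮⇒≥ (above-q i<j)) λ q≡bead → q∉L (suc i , s≤s z≤n , q≡bead)
  m≤part[j] : ∀ {j′} → j ≡ suc j′ → m ≤ part L j
  m≤part[j] {j′} refl = ℕₚ.+-cancelʳ-≤ j _ _ (ℕ.s≤s⁻¹ (subst (m ℕ.+ j ℕ.<_) (ℕₚ.+-suc (part L j) j)
    (bead-<⇒ {m} {suc j} {part L j} {j} {c} (subst (ℤ._< bead (part L j) j c) q≡ (q<bead ℕₚ.≤-refl)))))
  fits : Fits L j m
  fits = record
    { j≤length = j≤h
    ; part<m = ℕₚ.m<m+n _ (s≤s z≤n)
    ; m≤part = λ 1≤k k≤j →
        ℕₚ.≤-trans (m≤part[j] (sym (ℕₚ.suc-pred j ⦃ ℕ.>-nonZero (ℕₚ.≤-trans 1≤k k≤j) ⦄)))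
                                       (isPartition⇒nonIncreasing L-partition 1≤k k≤j)
    }

-- Rim hooks reaching the first column

RimComplement : List ℕ → List ℕ → Node → Set
RimComplement L μ γ = ∀ n → (InY L n → InY μ n × ¬ InRim μ γ n) × (InY μ n × ¬ InRim μ γ n → InY L n)

HookRows : List ℕ → List ℕ → ℕ → Set
HookRows L μ a = ∀ {x} → 1 ≤ x → (x < a → part L x ≡ part μ x) × (a ≤ x → part L x ≡ part μ (suc x) ℕ.∸ 1)

notInRim⇒<next : ∀ {μ a x y} → InY μ (x , y) → a ≤ x → ¬ InRim μ (a , 1) (x , y) → suc y ≤ part μ (suc x)
notInRim⇒<next {μ} {a} {x} {y} (1≤x , 1≤y , y≤μx) a≤x ∉rim with inY? μ (suc x , suc y)
... | yes (_ , _ , y<μx+1) = y<μx+1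
... | no ∉Y = ⊥-elim (∉rim ((1≤x , 1≤y , y≤μx) , a≤x , 1≤y , ∉Y))

<next⇒notInRim : ∀ {μ a x y} → suc y ≤ part μ (suc x) → ¬ InRim μ (a , 1) (x , y)
<next⇒notInRim y<μx+1 (_ , _ , _ , ∉Y) = ∉Y (s≤s z≤n , s≤s z≤n , y<μx+1)

rimComplement⇒hookRows : ∀ {L μ a} → NonIncreasing μ → RimComplement L μ (a , 1) → HookRows L μ a
rimComplement⇒hookRows {L} {μ} {a} desc Y≡ {x} 1≤x = above , below
  where
  above : x < a → part L x ≡ part μ x
  above x<a = ℕₚ.≤-antisym
    (≤-byElements λ 1≤y y≤Lx → proj₂ (proj₂ (proj₁ (proj₁ (Y≡ _) (1≤x , 1≤y , y≤Lx)))))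
    (≤-byElements λ 1≤y y≤μx → proj₂ (proj₂ (proj₂ (Y≡ _)
      ((1≤x , 1≤y , y≤μx) , λ rim → ℕₚ.<⇒≱ x<a (proj₁ (proj₂ rim))))))
  below : a ≤ x → part L x ≡ part μ (suc x) ℕ.∸ 1
  below a≤x = ℕₚ.≤-antisym
    (≤-byElements λ 1≤y y≤Lx → let (∈Yμ , ∉rim) = proj₁ (Y≡ _) (1≤x , 1≤y , y≤Lx) in
      suc≤⇒≤∸1 (notInRim⇒<next {μ} ∈Yμ a≤x ∉rim))
    (≤-byElements λ 1≤y y≤ → let y<μx+1 = ≤∸1⇒suc≤ 1≤y y≤ in
      proj₂ (proj₂ (proj₂ (Y≡ _)
        ((1≤x , 1≤y , ℕₚ.≤-trans (ℕₚ.<⇒≤ y<μx+1) (desc 1≤x (ℕₚ.n≤1+n x))) ,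
         <next⇒notInRim {μ} y<μx+1))))

hookRows⇒rimComplement : ∀ {L μ a} → NonIncreasing μ → HookRows L μ a → RimComplement L μ (a , 1)
hookRows⇒rimComplement {L} {μ} {a} desc rows (x , y) = toμ , fromμ
  where
  toμ : InY L (x , y) → InY μ (x , y) × ¬ InRim μ (a , 1) (x , y)
  toμ (1≤x , 1≤y , y≤Lx) with x ℕ.<? a
  ... | yes x<a =
    (1≤x , 1≤y , subst (y ≤_) (proj₁ (rows 1≤x) x<a) y≤Lx) , λ rim → ℕₚ.<⇒≱ x<a (proj₁ (proj₂ rim))
  ... | no x≮a = let y<μx+1 = ≤∸1⇒suc≤ 1≤y (subst (y ≤_) (proj₂ (rows 1≤x) (ℕₚ.≮⇒≥ x≮a)) y≤Lx) in
    (1≤x , 1≤y , ℕₚ.≤-trans (ℕₚ.<⇒≤ y<μx+1) (desc 1≤x (ℕₚ.n≤1+n x))) , <next⇒notInRim {μ} y<μx+1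
  fromμ : InY μ (x , y) × ¬ InRim μ (a , 1) (x , y) → InY L (x , y)
  fromμ ((1≤x , 1≤y , y≤μx) , ∉rim) with x ℕ.<? a
  ... | yes x<a = 1≤x , 1≤y , subst (y ≤_) (sym (proj₁ (rows 1≤x) x<a)) y≤μx
  ... | no x≮a = let a≤x = ℕₚ.≮⇒≥ x≮a in
    1≤x , 1≤y ,
    subst (y ≤_) (sym (proj₂ (rows 1≤x) a≤x)) (suc≤⇒≤∸1 (notInRim⇒<next {μ} (1≤x , 1≤y , y≤μx) a≤x ∉rim))

module _ {P : Pred Node 0ℓ} (P? : Decidable P) where
  open Equivalence

  count-row : ∀ a (f : ℕ → ℕ) n t → (∀ {i} → i < n → P (a , suc (f i)) ⇔ t ≤ i) →
    length (filter P? (map (λ b → a , suc b) (applyUpTo f n))) ≡ n ℕ.∸ t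
  count-row a f zero t _ = sym (ℕₚ.0∸n≡0 t)
  count-row a f (suc n) zero P⇔ = trans (cong length (Listₚ.filter-accept P? (from (P⇔ (s≤s z≤n)) z≤n)))
    (cong suc (count-row a (f ∘ suc) n zero λ i<n → mk⇔ (λ _ → z≤n) (λ _ → from (P⇔ (s≤s i<n)) z≤n)))
  count-row a f (suc n) (suc t) P⇔ = trans (cong length (Listₚ.filter-reject P? (λ p → case (to (P⇔ (s≤s z≤n)) p))))
    (count-row a (f ∘ suc) n t λ i<n → mk⇔ (ℕ.s≤s⁻¹ ∘ to (P⇔ (s≤s i<n))) (from (P⇔ (s≤s i<n)) ∘ s≤s))
    where
    case : ¬ (suc t ≤ 0)
    case ()

  count-nodesFrom : ∀ r μ M →
    (∀ i {b} → b < part μ (suc i) → P (r ℕ.+ i , suc b) ⇔ part M (suc i) ≤ b) →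
    (∀ i → part M (suc i) ≤ part μ (suc i)) → length M ≤ length μ →
    length (filter P? (nodesFrom r μ)) ℕ.+ sum M ≡ sum μ
  count-nodesFrom r [] [] _ _ _ = refl
  count-nodesFrom r (x ∷ μ) M P⇔ M≤μ length≤ = begin
    length (filter P? (rowNodes r x ++ nodesFrom (suc r) μ)) ℕ.+ sum M
      ≡⟨ cong (ℕ._+ sum M) (trans (cong length (Listₚ.filter-++ P? (rowNodes r x) _))
                                  (Listₚ.length-++ (filter P? (rowNodes r x)))) ⟩
    (length (filter P? (rowNodes r x)) ℕ.+ length (filter P? (nodesFrom (suc r) μ))) ℕ.+ sum M
      ≡⟨ cong₂ (λ s t → (s ℕ.+ length (filter P? (nodesFrom (suc r) μ))) ℕ.+ t) first-row (sum-drop1 M) ⟩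
    ((x ℕ.∸ part M 1) ℕ.+ length (filter P? (nodesFrom (suc r) μ))) ℕ.+ (part M 1 ℕ.+ sum (drop 1 M))
      ≡⟨ identity (x ℕ.∸ part M 1) (part M 1) _ _ ⟩
    ((x ℕ.∸ part M 1) ℕ.+ part M 1) ℕ.+ (length (filter P? (nodesFrom (suc r) μ)) ℕ.+ sum (drop 1 M))
      ≡⟨ cong₂ ℕ._+_ (ℕₚ.m∸n+n≡m (M≤μ 0))
                     (count-nodesFrom (suc r) μ (drop 1 M) rest-P⇔ rest-M≤μ (length-drop1 M length≤)) ⟩
    x ℕ.+ sum μ ∎
    where
    open ≡-Reasoning
    identity : ∀ d y F S → (d ℕ.+ F) ℕ.+ (y ℕ.+ S) ≡ (d ℕ.+ y) ℕ.+ (F ℕ.+ S)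
    identity = ℕSolver.solve-∀
    first-row : length (filter P? (rowNodes r x)) ≡ x ℕ.∸ part M 1
    first-row = count-row r (λ b → b) x (part M 1) λ {b} b<x →
      subst (λ t → P (t , suc b) ⇔ part M 1 ≤ b) (ℕₚ.+-identityʳ r) (P⇔ 0 b<x)
    sum-drop1 : ∀ M → sum M ≡ part M 1 ℕ.+ sum (drop 1 M)
    sum-drop1 [] = refl
    sum-drop1 (_ ∷ _) = refl
    part-drop1 : ∀ M i → part (drop 1 M) (suc i) ≡ part M (suc (suc i))
    part-drop1 [] i = refl
    part-drop1 (_ ∷ _) i = refl
    length-drop1 : ∀ M → length M ≤ suc (length μ) → length (drop 1 M) ≤ length μ
    length-drop1 [] _ = z≤n
    length-drop1 (_ ∷ _) (s≤s ≤μ) = ≤μ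
    rest-P⇔ : ∀ i {b} → b < part μ (suc i) → P (suc r ℕ.+ i , suc b) ⇔ part (drop 1 M) (suc i) ≤ b
    rest-P⇔ i {b} b<μ =
      subst₂ (λ t u → P (t , suc b) ⇔ u ≤ b) (ℕₚ.+-suc r i) (sym (part-drop1 M i)) (P⇔ (suc i) b<μ)
    rest-M≤μ : ∀ i → part (drop 1 M) (suc i) ≤ part μ (suc i)
    rest-M≤μ i = subst (_≤ _) (sym (part-drop1 M i)) (M≤μ (suc i))

rimComplement⇒part≤ : ∀ {L μ γ} → RimComplement L μ γ → ∀ i → part L (suc i) ≤ part μ (suc i)
rimComplement⇒part≤ Y≡ i =
  ≤-byElements λ 1≤y y≤L → proj₂ (proj₂ (proj₁ (proj₁ (Y≡ _) (s≤s z≤n , 1≤y , y≤L))))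

length-≤ : ∀ {L μ} → Positive L → (∀ i → part L (suc i) ≤ part μ (suc i)) → length L ≤ length μ
length-≤ {L} {μ} pos L≤μ = go (length L) ℕₚ.≤-refl
  where
  go : ∀ k → k ≤ length L → k ≤ length μ
  go zero _ = z≤n
  go (suc k) k<h = part>0⇒≤length μ (ℕₚ.<-≤-trans (part-positive pos (s≤s z≤n) k<h) (L≤μ k))

rimSize+sum≡sum : ∀ {L μ γ} → Positive L → RimComplement L μ γ → rimSize μ γ ℕ.+ sum L ≡ sum μ
rimSize+sum≡sum {L} {μ} {γ} pos Y≡ =
  count-nodesFrom (inRim? μ γ) 1 μ L rows L≤μ (length-≤ {L} {μ} pos L≤μ)
  where
  L≤μ : ∀ i → part L (suc i) ≤ part μ (suc i)
  L≤μ = rimComplement⇒part≤ {L} {μ} {γ} Y≡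
  rows : ∀ i {b} → b < part μ (suc i) → InRim μ γ (suc i , suc b) ⇔ part L (suc i) ≤ b
  rows i {b} b<μ = mk⇔ inRim⇒ ⇒inRim
    where
    inRim⇒ : InRim μ γ (suc i , suc b) → part L (suc i) ≤ b
    inRim⇒ rim = ℕₚ.≮⇒≥ λ b<L → proj₂ (proj₁ (Y≡ _) (s≤s z≤n , s≤s z≤n , b<L)) rim
    ⇒inRim : part L (suc i) ≤ b → InRim μ γ (suc i , suc b)
    ⇒inRim L≤b with inRim? μ γ (suc i , suc b)
    ... | yes rim = rim
    ... | no ∉rim =
      ⊥-elim (ℕₚ.<⇒≱ (proj₂ (proj₂ (proj₂ (Y≡ _) ((s≤s z≤n , s≤s z≤n , b<μ) , ∉rim)))) L≤b)

inRim-rowEnd : ∀ {μ a b} → NonIncreasing μ → 1 ≤ a → 1 ≤ part μ a → b ≤ part μ a →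
  InRim μ (a , b) (a , part μ a)
inRim-rowEnd {μ} {a} desc 1≤a 1≤μa b≤μa = (1≤a , 1≤μa , ℕₚ.≤-refl) , ℕₚ.≤-refl , b≤μa ,
  λ (_ , _ , μa<μ[a+1]) → ℕₚ.<-irrefl refl (ℕₚ.≤-trans μa<μ[a+1] (desc 1≤a (ℕₚ.n≤1+n a)))

isHand-rowEnd : ∀ {μ a b} → NonIncreasing μ → 1 ≤ a → 1 ≤ part μ a → b ≤ part μ a →
  IsHand μ (a , b) (a , part μ a)
isHand-rowEnd {μ} desc 1≤a 1≤μa b≤μa =
  inRim-rowEnd {μ} desc 1≤a 1≤μa b≤μa , refl , λ _ rim → proj₂ (proj₂ (proj₁ rim))

isHand⇒≡rowEnd : ∀ {μ a b x y} → NonIncreasing μ → IsHand μ (a , b) (x , y) → (x , y) ≡ (a , part μ a)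
isHand⇒≡rowEnd {μ} desc (((1≤a , 1≤y , y≤μa) , _ , b≤y , _) , refl , maximal) =
  cong (_ ,_) (ℕₚ.≤-antisym y≤μa
    (maximal _ (inRim-rowEnd {μ} desc 1≤a (ℕₚ.≤-trans 1≤y y≤μa) (ℕₚ.≤-trans b≤y y≤μa))))

record IsRowInsertion (L μ : List ℕ) (γ : Node) : Set where
  field
    j m : ℕ
    fits : Fits L j m
    γ≡ : γ ≡ (suc j , 1)
    μ≡ : μ ≡ insertRow j m L

module ColumnHook {L μ j} (L-partition : IsPartition L) (adds : AddsRimHook L μ (suc j , 1))
                  (one-below : ExactlyOneBelow L μ (suc j , 1)) where
  h : ℕ
  h = length L
  m : ℕ
  m = part μ (suc j)

  μ-desc : NonIncreasing μ
  μ-desc = isPartition⇒nonIncreasing (proj₁ adds)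

  rows : HookRows L μ (suc j)
  rows = rimComplement⇒hookRows {L} {μ} μ-desc (proj₂ (proj₂ adds))

  x₀ : ℕ
  x₀ = proj₁ one-below
  x₀-inRim : InRim μ (suc j , 1) (x₀ , 1)
  x₀-inRim = proj₁ (proj₁ (proj₂ one-below))
  h<x₀ : h < x₀
  h<x₀ = proj₂ (proj₁ (proj₂ one-below))
  x₀-unique : ∀ x → InRim μ (suc j , 1) (x , 1) → h < x → x ≡ x₀
  x₀-unique = proj₂ (proj₂ one-below)

  1≤m : 1 ≤ m
  1≤m = proj₂ (proj₂ (proj₁ (proj₂ adds)))

  1≤μ[h+1] : 1 ≤ part μ (suc h)
  1≤μ[h+1] = ℕₚ.≤-trans (proj₂ (proj₂ (proj₁ x₀-inRim))) (μ-desc (s≤s z≤n) h<x₀)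

  j≤h : j ≤ h
  j≤h = ℕₚ.≮⇒≥ λ h<j → ℕₚ.<-irrefl
    (trans (sym (part-length< L ℕₚ.≤-refl)) (proj₁ (rows (s≤s z≤n)) (s≤s h<j))) 1≤μ[h+1]

  μ≤1-below : ∀ {x} → h < x → part μ (suc x) ≤ 1
  μ≤1-below h<x = ∸1≡0⇒≤1 (trans
    (sym (proj₂ (rows (ℕₚ.≤-trans (s≤s z≤n) h<x)) (ℕₚ.≤-trans (s≤s j≤h) h<x)))
    (part-length< L h<x))

  inRim-below : ∀ {x} → h < x → 1 ≤ part μ x → InRim μ (suc j , 1) (x , 1)
  inRim-below h<x 1≤μx =
    (ℕₚ.≤-trans (s≤s z≤n) h<x , s≤s z≤n , 1≤μx) , ℕₚ.≤-trans (s≤s j≤h) h<x , s≤s z≤n ,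
    λ (_ , _ , 2≤μ) → ℕₚ.<-irrefl refl (ℕₚ.≤-trans 2≤μ (μ≤1-below h<x))

  -- Otherwise (h + 1 , 1) and (h + 2 , 1) would both be nodes of the hook below L.
  μ[h+2]≡0 : part μ (suc (suc h)) ≡ 0
  μ[h+2]≡0 = ℕₚ.n≤0⇒n≡0 (ℕₚ.≮⇒≥ λ 1≤μ[h+2] → ℕₚ.1+n≢n (trans
    (x₀-unique _ (inRim-below (ℕₚ.n≤1+n _) 1≤μ[h+2]) (ℕₚ.n≤1+n _))
    (sym (x₀-unique _ (inRim-below ℕₚ.≤-refl 1≤μ[h+1]) ℕₚ.≤-refl))))

  fits : Fits L j m
  fits = record
    { j≤length = j≤h
    ; part<m = subst (_< m) (sym (proj₂ (rows (s≤s z≤n)) ℕₚ.≤-refl))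
                 (≤⇒suc[∸1]≤ (μ-desc (s≤s z≤n) (ℕₚ.n≤1+n _)) 1≤m)
    ; m≤part = λ 1≤k k≤j →
        subst (m ≤_) (sym (proj₁ (rows 1≤k) (s≤s k≤j))) (μ-desc 1≤k (ℕₚ.m≤n⇒m≤1+n k≤j))
    }

  part-below : ∀ {k} → j < k → part μ (suc k) ≡ part (map suc L) k
  part-below {k} j<k with k ℕ.≤? h
  ... | yes k≤h = begin
    part μ (suc k)                    ≡⟨ ℕₚ.suc-pred _ ⦃ ℕ.>-nonZero μ>0 ⦄ ⟨
    suc (part μ (suc k) ℕ.∸ 1)        ≡⟨ cong suc L≡ ⟨
    suc (part L k)                    ≡⟨ part-map-suc L 1≤k k≤h ⟨
    part (map suc L) k                ∎
    where
    open ≡-Reasoning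
    1≤k : 1 ≤ k
    1≤k = ℕₚ.≤-trans (s≤s z≤n) j<k
    L≡ : part L k ≡ part μ (suc k) ℕ.∸ 1
    L≡ = proj₂ (rows 1≤k) j<k
    μ>0 : 0 < part μ (suc k)
    μ>0 = ℕₚ.≤-trans (subst (0 <_) L≡ (part-positive (proj₂ L-partition) 1≤k k≤h)) (ℕₚ.m∸n≤m _ 1)
  ... | no k≰h = trans
    (ℕₚ.n≤0⇒n≡0 (ℕₚ.≤-trans (μ-desc (s≤s z≤n) (s≤s (ℕₚ.≰⇒> k≰h))) (ℕₚ.≤-reflexive μ[h+2]≡0)))
    (sym (part-length< (map suc L) (subst (_< k) (sym (Listₚ.length-map suc L)) (ℕₚ.≰⇒> k≰h))))

  μ≡insertRow : μ ≡ insertRow j m L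
  μ≡insertRow = part-ext (proj₂ (proj₁ adds)) (positive-insertRow L (proj₂ L-partition) 1≤m) same-part
    where
    same-part : ∀ k → 1 ≤ k → part μ k ≡ part (insertRow j m L) k
    same-part (suc k) 1≤k with ℕₚ.<-cmp k j
    ... | tri< k<j _ _ = sym (trans (part-insertRow-≤ m L 1≤k k<j j≤h) (proj₁ (rows 1≤k) (s≤s k<j)))
    ... | tri≈ _ refl _ = sym (part-insertRow-new m L j≤h)
    ... | tri> _ _ j<k = trans (part-below j<k) (sym (part-insertRow-> m L j<k j≤h))

rimHookBelow⇒rowInsertion : ∀ {L μ γ} → IsPartition L → AddsRimHook L μ γ → ExactlyOneBelow L μ γ →
  IsRowInsertion L μ γ
rimHookBelow⇒rowInsertion {γ = zero , _} _ (_ , (() , _) , _) _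
rimHookBelow⇒rowInsertion {γ = suc j , zero} _ (_ , (_ , () , _) , _) _
rimHookBelow⇒rowInsertion {γ = suc j , suc zero} L-partition adds below =
  record { j = j ; m = m ; fits = fits ; γ≡ = refl ; μ≡ = μ≡insertRow }
  where open ColumnHook L-partition adds below
rimHookBelow⇒rowInsertion {γ = suc j , suc (suc b)} _ _ (_ , ((_ , _ , s≤s () , _) , _) , _)

insertRow-hookRows : ∀ {L j m} → Fits L j m → HookRows L (insertRow j m L) (suc j)
insertRow-hookRows {L} {j} {m} fits {x} 1≤x = above , below
  where
  open Fits fits
  above : x < suc j → part L x ≡ part (insertRow j m L) x
  above x≤j = sym (part-insertRow-≤ m L 1≤x (ℕ.s≤s⁻¹ x≤j) j≤length)
  below : suc j ≤ x → part L x ≡ part (insertRow j m L) (suc x) ℕ.∸ 1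
  below j<x = trans (sym (part-map-suc-∸1 L x)) (cong (ℕ._∸ 1) (sym (part-insertRow-> m L j<x j≤length)))

insertRow-addsRimHook : ∀ {L j m} → IsPartition L → Fits L j m → AddsRimHook L (insertRow j m L) (suc j , 1)
insertRow-addsRimHook {L} {j} {m} L-partition fits =
  μ-partition , (s≤s z≤n , s≤s z≤n , subst (1 ≤_) (sym (part-insertRow-new m L (Fits.j≤length fits))) 1≤m) ,
  hookRows⇒rimComplement {L} {insertRow j m L} (isPartition⇒nonIncreasing μ-partition) (insertRow-hookRows fits)
  where
  μ-partition : IsPartition (insertRow j m L)
  μ-partition = insertRow-isPartition L-partition fits
  1≤m : 1 ≤ m
  1≤m = ℕₚ.<-≤-trans (s≤s z≤n) (Fits.part<m fits)

insertRow-exactlyOneBelow : ∀ {L j m} → IsPartition L → Fits L j m →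
  ExactlyOneBelow L (insertRow j m L) (suc j , 1)
insertRow-exactlyOneBelow {L} {j} {m} L-partition fits =
  suc h , ((inY , s≤s (Fits.j≤length fits) , s≤s z≤n , ∉Y-next) , ℕₚ.≤-refl) , unique
  where
  h : ℕ
  h = length L
  μ : List ℕ
  μ = insertRow j m L
  length-μ : length μ ≡ suc h
  length-μ = length-insertRow m L (Fits.j≤length fits)
  inY : InY μ (suc h , 1)
  inY = s≤s z≤n , s≤s z≤n ,
    part-positive (proj₂ (insertRow-isPartition L-partition fits)) (s≤s z≤n) (ℕₚ.≤-reflexive (sym length-μ))
  ∉Y-next : ¬ InY μ (suc (suc h) , 2)
  ∉Y-next (_ , _ , 2≤μ) with () ← subst (2 ≤_) (part-length< μ (ℕₚ.≤-reflexive (cong suc length-μ))) 2≤μ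
  unique : ∀ x → InRim μ (suc j , 1) (x , 1) → h < x → x ≡ suc h
  unique x ((_ , _ , 1≤μx) , _) h<x =
    ℕₚ.≤-antisym (subst (x ≤_) length-μ (part>0⇒≤length μ 1≤μx)) h<x

rimSize-insertRow : ∀ {L j m} → IsPartition L → Fits L j m →
  rimSize (insertRow j m L) (suc j , 1) ℕ.+ j ≡ m ℕ.+ length L
rimSize-insertRow {L} {j} {m} L-partition fits = ℕₚ.+-cancelʳ-≡ (sum L) _ _ (begin
  (s ℕ.+ j) ℕ.+ sum L        ≡⟨ identity₁ s j (sum L) ⟩
  (s ℕ.+ sum L) ℕ.+ j        ≡⟨ cong (ℕ._+ j) (rimSize+sum≡sum {L} {μ} {suc j , 1} (proj₂ L-partition) Y≡) ⟩
  sum μ ℕ.+ j                ≡⟨ sum-insertRow m L (Fits.j≤length fits) ⟩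
  (sum L ℕ.+ m) ℕ.+ length L ≡⟨ identity₂ (sum L) m (length L) ⟩
  (m ℕ.+ length L) ℕ.+ sum L ∎)
  where
  open ≡-Reasoning
  μ : List ℕ
  μ = insertRow j m L
  s : ℕ
  s = rimSize μ (suc j , 1)
  Y≡ : RimComplement L μ (suc j , 1)
  Y≡ = proj₂ (proj₂ (insertRow-addsRimHook L-partition fits))
  identity₁ : ∀ s j t → (s ℕ.+ j) ℕ.+ t ≡ (s ℕ.+ t) ℕ.+ j
  identity₁ = ℕSolver.solve-∀
  identity₂ : ∀ t m h → (t ℕ.+ m) ℕ.+ h ≡ (m ℕ.+ h) ℕ.+ t
  identity₂ = ℕSolver.solve-∀

-- The size of the hook is its new bead position up to a shift that does not depend on the hook.
rimSize-insertRow-bead : ∀ {L j m} → IsPartition L → Fits L j m → ∀ c →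
  + rimSize (insertRow j m L) (suc j , 1) ℤ.+ c ≡ bead m (suc j) c ℤ.+ + length L
rimSize-insertRow-bead {L} {j} {m} L-partition fits c = begin
  + s ℤ.+ c                                 ≡⟨ identity₁ (+ s) (+ j) c ⟩
  ((+ s ℤ.+ + j) ℤ.+ c) - + j               ≡⟨ cong (λ t → (t ℤ.+ c) - + j) size ⟩
  ((+ m ℤ.+ + length L) ℤ.+ c) - + j        ≡⟨ shift ⟩
  bead m (suc j) c ℤ.+ + length L           ∎
  where
  open ≡-Reasoning
  s : ℕ
  s = rimSize (insertRow j m L) (suc j , 1)
  size : + s ℤ.+ + j ≡ + m ℤ.+ + length L
  size = trans (sym (ℤₚ.pos-+ s j)) (trans (cong +_ (rimSize-insertRow L-partition fits)) (ℤₚ.pos-+ m (length L)))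
  identity₁ : ∀ s j c → s ℤ.+ c ≡ ((s ℤ.+ j) ℤ.+ c) - j
  identity₁ = solve-∀
  identity₂ : ∀ m j h c → ((m ℤ.+ h) ℤ.+ c) - j ≡ (((m - (+ 1 ℤ.+ j)) ℤ.+ c) ℤ.+ + 1) ℤ.+ h
  identity₂ = solve-∀
  shift : ((+ m ℤ.+ + length L) ℤ.+ c) - + j ≡ bead m (suc j) c ℤ.+ + length L
  shift rewrite ℤₚ.pos-+ 1 j = identity₂ (+ m) (+ j) (+ length L) c

rimSize-≤⇔bead-≤ : ∀ {L j m j′ m′} → IsPartition L → Fits L j m → Fits L j′ m′ → ∀ c →
  rimSize (insertRow j m L) (suc j , 1) ≤ rimSize (insertRow j′ m′ L) (suc j′ , 1) ⇔
  bead m (suc j) c ℤ.≤ bead m′ (suc j′) c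
rimSize-≤⇔bead-≤ {L} {j} {m} {j′} {m′} L-partition fits fits′ c = mk⇔
  (λ s≤s′ → +-cancelʳ-≤ (+ length L) (subst₂ ℤ._≤_ size≡ size≡′ (ℤₚ.+-monoˡ-≤ c (ℤ.+≤+ s≤s′))))
  (λ b≤b′ → ℤₚ.drop‿+≤+ (+-cancelʳ-≤ c
    (subst₂ ℤ._≤_ (sym size≡) (sym size≡′) (ℤₚ.+-monoˡ-≤ (+ length L) b≤b′))))
  where
  size≡ : + rimSize (insertRow j m L) (suc j , 1) ℤ.+ c ≡ bead m (suc j) c ℤ.+ + length L
  size≡ = rimSize-insertRow-bead L-partition fits c
  size≡′ : + rimSize (insertRow j′ m′ L) (suc j′ , 1) ℤ.+ c ≡ bead m′ (suc j′) c ℤ.+ + length L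
  size≡′ = rimSize-insertRow-bead L-partition fits′ c

insertRow-validHook : ∀ {e C r L j m} → IsPartition L → Fits L j m → bead m (suc j) C ≡ r [mod e ] →
  ValidHook e C (r - + 1) L (insertRow j m L) (suc j , 1)
insertRow-validHook {e} {C} {r} {L} {j} {m} L-partition fits bead≡r =
  adds , insertRow-exactlyOneBelow L-partition fits , (suc j , m) , hand ,
  Equivalence.from (residue≡⇔bead≡ C (suc j) m r) bead≡r
  where
  μ : List ℕ
  μ = insertRow j m L
  adds : AddsRimHook L μ (suc j , 1)
  adds = insertRow-addsRimHook L-partition fits
  part-new : part μ (suc j) ≡ m
  part-new = part-insertRow-new m L (Fits.j≤length fits)
  1≤μ[j+1] : 1 ≤ part μ (suc j)
  1≤μ[j+1] = proj₂ (proj₂ (proj₁ (proj₂ adds)))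
  hand : IsHand μ (suc j , 1) (suc j , m)
  hand = subst (λ a → IsHand μ (suc j , 1) (suc j , a)) part-new
    (isHand-rowEnd {μ} (isPartition⇒nonIncreasing (proj₁ adds)) (s≤s z≤n) 1≤μ[j+1] 1≤μ[j+1])

validHook⇒rowInsertion : ∀ {e C r L μ γ} → IsPartition L → ValidHook e C (r - + 1) L μ γ →
  Σ (IsRowInsertion L μ γ) λ ins → bead (IsRowInsertion.m ins) (suc (IsRowInsertion.j ins)) C ≡ r [mod e ]
validHook⇒rowInsertion {e} {C} {r} {L} L-partition (adds , below , hand , isHand , residue≡)
  with rimHookBelow⇒rowInsertion L-partition adds below
... | ins@record { j = j ; m = m ; fits = fits ; γ≡ = refl ; μ≡ = refl } =
  ins , Equivalence.to (residue≡⇔bead≡ C (suc j) m r) (subst (λ h → residue C h ≡ r - + 1 [mod e ]) hand≡ residue≡)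
  where
  μ : List ℕ
  μ = insertRow j m L
  hand≡ : hand ≡ (suc j , m)
  hand≡ = trans (isHand⇒≡rowEnd {μ} (isPartition⇒nonIncreasing (proj₁ adds)) isHand)
                (cong (suc j ,_) (part-insertRow-new m L (Fits.j≤length fits)))

-- The affine symmetric group on the abacus

module _ {e} (w : AffSym e) where

  fun-∸e : ∀ i → fun w (i - + e) ≡ fun w i - + e
  fun-∸e i = begin
    fun w (i - + e)                   ≡⟨ i+j-j≡i _ (+ e) ⟨
    (fun w (i - + e) ℤ.+ + e) - + e   ≡⟨ cong (_- + e) (periodic w (i - + e)) ⟨
    fun w ((i - + e) ℤ.+ + e) - + e   ≡⟨ cong (λ t → fun w t - + e) (identity i (+ e)) ⟩
    fun w i - + e                     ∎
    where
    open ≡-Reasoning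
    identity : ∀ i e → (i - e) ℤ.+ e ≡ i
    identity = solve-∀

  fun-∸multiple : ∀ i n → fun w (i - + (n ℕ.* e)) ≡ fun w i - + (n ℕ.* e)
  fun-∸multiple i zero = trans (cong (fun w) (ℤₚ.+-identityʳ i)) (sym (ℤₚ.+-identityʳ (fun w i)))
  fun-∸multiple i (suc n) rewrite ℤₚ.pos-+ e (n ℕ.* e) = begin
    fun w (i - (+ e ℤ.+ + (n ℕ.* e)))   ≡⟨ cong (fun w) (identity i (+ e) (+ (n ℕ.* e))) ⟩
    fun w ((i - + (n ℕ.* e)) - + e)     ≡⟨ fun-∸e (i - + (n ℕ.* e)) ⟩
    fun w (i - + (n ℕ.* e)) - + e       ≡⟨ cong (_- + e) (fun-∸multiple i n) ⟩
    (fun w i - + (n ℕ.* e)) - + e       ≡⟨ identity (fun w i) (+ e) (+ (n ℕ.* e)) ⟨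
    fun w i - (+ e ℤ.+ + (n ℕ.* e))     ∎
    where
    open ≡-Reasoning
    identity : ∀ i e f → i - (e ℤ.+ f) ≡ (i - f) - e
    identity = solve-∀

  abacus-act : ∀ {c ν} → Acts w [] c ν → ∀ x → InAbacus ν c x ⇔ (∃ λ y → y ℤ.≤ c × fun w y ≡ x)
  abacus-act (_ , act) x = mk⇔
    (λ x∈ν → let (y , y∈∅ , wy≡x) = proj₁ (act x) x∈ν in y , ∈abacus∅⇒≤ y∈∅ , wy≡x)
    (λ (y , y≤c , wy≡x) → proj₂ (act x) (y , ≤⇒∈abacus∅ y≤c , wy≡x))

  <⇒≤-1 : ∀ {i j} → i ℤ.< j → i ℤ.≤ j - + 1
  <⇒≤-1 {i} {j} i<j = subst (i ℤ.≤_) (ℤₚ.+-comm (ℤ.- + 1) j) (ℤₚ.i<j⇒i≤pred[j] i<j)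

  -1< : ∀ c → c - + 1 ℤ.< c
  -1< c = ℤₚ.i≤pred[j]⇒i<j (ℤₚ.≤-reflexive (ℤₚ.+-comm c (ℤ.- + 1)))

  abacus-step : ∀ {c L L′} → Acts w [] (c - + 1) L → Acts w [] c L′ → ∀ x →
    InAbacus L′ c x ⇔ (InAbacus L (c - + 1) x ⊎ x ≡ fun w c)
  abacus-step {c} {L} {L′} act act′ x = mk⇔ to from
    where
    to : InAbacus L′ c x → InAbacus L (c - + 1) x ⊎ x ≡ fun w c
    to x∈L′ with Equivalence.to (abacus-act act′ x) x∈L′
    ... | y , y≤c , wy≡x with y ℤ.≟ c
    ...   | yes refl = inj₂ (sym wy≡x)
    ...   | no y≢c = inj₁ (Equivalence.from (abacus-act act x) (y , <⇒≤-1 (ℤₚ.≤∧≢⇒< y≤c y≢c) , wy≡x))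
    from : InAbacus L (c - + 1) x ⊎ x ≡ fun w c → InAbacus L′ c x
    from (inj₁ x∈L) with Equivalence.to (abacus-act act x) x∈L
    ... | y , y≤c-1 , wy≡x =
      Equivalence.from (abacus-act act′ x) (y , ℤₚ.≤-trans y≤c-1 (ℤₚ.<⇒≤ (-1< c)) , wy≡x)
    from (inj₂ x≡wc) = Equivalence.from (abacus-act act′ x) (c , ℤₚ.≤-refl , sym x≡wc)

  fun-charge∉abacus : ∀ {c L} → Acts w [] (c - + 1) L → ¬ InAbacus L (c - + 1) (fun w c)
  fun-charge∉abacus {c} act wc∈L with Equivalence.to (abacus-act act _) wc∈L
  ... | y , y≤c-1 , wy≡wc with proj₁ (bij w) wy≡wc
  ...   | refl = ℤₚ.<-irrefl refl (ℤₚ.≤-<-trans y≤c-1 (-1< c))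

  bottom<fun-charge : ∀ {c L} → Acts w [] (c - + 1) L → bead 0 (suc (length L)) (c - + 1) ℤ.< fun w c
  bottom<fun-charge {L = L} act = ℤₚ.≰⇒> λ wc≤bottom → fun-charge∉abacus act (≤bottom⇒∈abacus {L} wc≤bottom)

  -- L is an e-core: w c − t e = w (c − t e) is a bead of L for t ≥ 1.
  congruentGap⇒fun-charge≤ : ∀ {c L y} → 1 ≤ e → Acts w [] (c - + 1) L → ¬ InAbacus L (c - + 1) y →
    y ≡ fun w c [mod e ] → fun w c ℤ.≤ y
  congruentGap⇒fun-charge≤ {c} {L} {y} 1≤e act y∉L (divides t ∣y-wc∣≡te) =
    ℤₚ.≮⇒≥ λ y<wc → y∉L (lower-beads t (y≡ y<wc) y<wc)
    where
    wc : ℤ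
    wc = fun w c
    y≡ : y ℤ.< wc → y ≡ wc - + (t ℕ.* e)
    y≡ y<wc = begin
      y                   ≡⟨ identity wc y ⟩
      wc - (wc - y)       ≡⟨ cong (wc -_) (ℤₚ.0≤i⇒+∣i∣≡i (ℤₚ.i≤j⇒0≤j-i (ℤₚ.<⇒≤ y<wc))) ⟨
      wc - + ℤ.∣ wc - y ∣ ≡⟨ cong (λ n → wc - + n) (trans (ℤₚ.∣i-j∣≡∣j-i∣ wc y) ∣y-wc∣≡te) ⟩
      wc - + (t ℕ.* e)    ∎
      where
      open ≡-Reasoning
      identity : ∀ a b → b ≡ a - (a - b)
      identity = solve-∀
    lower-beads : ∀ t → y ≡ wc - + (t ℕ.* e) → y ℤ.< wc → InAbacus L (c - + 1) y
    lower-beads zero y≡wc y<wc = ⊥-elim (ℤₚ.<-irrefl (trans y≡wc (ℤₚ.+-identityʳ wc)) y<wc)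
    lower-beads (suc t) y≡ _ = Equivalence.from (abacus-act act y)
      (c - + (suc t ℕ.* e) , ℤₚ.+-monoʳ-≤ c (ℤₚ.neg-mono-≤ (ℤ.+≤+ (ℕₚ.≤-trans 1≤e (ℕₚ.m≤m+n e _)))) ,
       trans (fun-∸multiple c (suc t)) (sym y≡))

-- The smallest hook

module _ {e} (1≤e : 1 ≤ e) (w : AffSym e) (c : ℤ) {L L′ : List ℕ}
         (act : Acts w [] (c - + 1) L) (act′ : Acts w [] c L′) where
  private
    C : ℤ
    C = c - + 1
    q : ℤ
    q = fun w c
    L-partition : IsPartition L
    L-partition = proj₁ act

  fun-charge≤position : ∀ {j m} → Fits L j m → bead m (suc j) C ≡ q [mod e ] → q ℤ.≤ bead m (suc j) C
  fun-charge≤position fits ≡q = congruentGap⇒fun-charge≤ w 1≤e act (fits⇒bead∉abacus L-partition fits) ≡q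

  fun-charge-insertion : ∃₂ λ j m → Fits L j m × q ≡ bead m (suc j) C
  fun-charge-insertion = gap⇒fits L-partition (fun-charge∉abacus w act) (bottom<fun-charge w act)

  module _ {j₀ m₀} (fits₀ : Fits L j₀ m₀) (q≡bead₀ : q ≡ bead m₀ (suc j₀) C) where
    private
      μ₀ : List ℕ
      μ₀ = insertRow j₀ m₀ L

    valid₀ : ValidHook e C (q - + 1) L μ₀ (suc j₀ , 1)
    valid₀ = insertRow-validHook L-partition fits₀
      (subst (λ p → p ≡ q [mod e ]) q≡bead₀ (divides 0 (cong ℤ.∣_∣ (ℤₚ.+-inverseʳ q))))

    minimal₀ : ∀ μ γ → ValidHook e C (q - + 1) L μ γ → rimSize μ₀ (suc j₀ , 1) ≤ rimSize μ γ
    minimal₀ μ γ valid with validHook⇒rowInsertion {r = q} L-partition valid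
    ... | record { fits = fits ; γ≡ = refl ; μ≡ = refl } , ≡q =
      Equivalence.from (rimSize-≤⇔bead-≤ L-partition fits₀ fits C)
        (subst (ℤ._≤ _) q≡bead₀ (fun-charge≤position fits ≡q))

    smallestHook₀ : SmallestHook e C (q - + 1) L μ₀ (suc j₀ , 1)
    smallestHook₀ = valid₀ , minimal₀

    smallestHook⇒removeFirstColumn : ∀ μ γ → SmallestHook e C (q - + 1) L μ γ → L′ ≡ removeFirstColumn μ
    smallestHook⇒removeFirstColumn μ γ (valid , minimal) with validHook⇒rowInsertion {r = q} L-partition valid
    ... | record { j = j ; m = m ; fits = fits ; γ≡ = refl ; μ≡ = refl } , ≡q =
      abacus-injective c (proj₂ (proj₁ act′)) (isPartition⇒nonIncreasing (proj₁ act′))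
        (positive-removeFirstColumn μ) (nonIncreasing-removeFirstColumn μ μ-desc) same-abacus
      where
      μ-desc : NonIncreasing (insertRow j m L)
      μ-desc = isPartition⇒nonIncreasing (insertRow-isPartition L-partition fits)
      position≡q : bead m (suc j) C ≡ q
      position≡q = ℤₚ.≤-antisym
        (subst (_ ℤ.≤_) (sym q≡bead₀)
          (Equivalence.to (rimSize-≤⇔bead-≤ L-partition fits fits₀ C) (minimal μ₀ (suc j₀ , 1) valid₀)))
        (fun-charge≤position fits ≡q)
      same-abacus : ∀ x → InAbacus L′ c x ⇔ InAbacus (removeFirstColumn μ) c x
      same-abacus x = ⇔.trans
        (subst (λ p → InAbacus L′ c x ⇔ (InAbacus L C x ⊎ x ≡ p)) (sym position≡q) (abacus-step w act act′ x))
        (⇔.sym (abacus-removeFirstColumn-insertRow L-partition fits c x))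

  smallestHook-characterisation :
    (∃₂ λ μ γ → SmallestHook e C (q - + 1) L μ γ) ×
    (∀ μ γ → SmallestHook e C (q - + 1) L μ γ → L′ ≡ removeFirstColumn μ)
  smallestHook-characterisation = from-insertion fun-charge-insertion
    where
    -- A helper rather than `with`: abstracting over fun-charge-insertion makes Agda normalise it.
    from-insertion : (∃₂ λ j m → Fits L j m × q ≡ bead m (suc j) C) →
      (∃₂ λ μ γ → SmallestHook e C (q - + 1) L μ γ) ×
      (∀ μ γ → SmallestHook e C (q - + 1) L μ γ → L′ ≡ removeFirstColumn μ)
    from-insertion (j₀ , m₀ , fits₀ , q≡bead₀) =
      (insertRow j₀ m₀ L , (suc j₀ , 1) , smallestHook₀ fits₀ q≡bead₀) ,
      smallestHook⇒removeFirstColumn fits₀ q≡bead₀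

theorem4p18 : (e : ℕ) → 2 ≤ e → (w : AffSym e) → (c : ℕ) → 1 ≤ c → c < e →
    (λc-1 λc : List ℕ) →
    Acts w [] (+ c - + 1) λc-1 →
    Acts w [] (+ c) λc →
    (∃₂ λ μ γ → SmallestHook e (+ c - + 1) (fun w (+ c) - + 1) λc-1 μ γ) ×
    (∀ μ γ → SmallestHook e (+ c - + 1) (fun w (+ c) - + 1) λc-1 μ γ →
    λc ≡ removeFirstColumn μ)
theorem4p18 e 2≤e w c _ _ λc-1 λc act act′ =
  smallestHook-characterisation (ℕₚ.≤-trans (s≤s z≤n) 2≤e) w (+ c) act act′
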